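{- Let $\mathcal G$ be the category of finite groups and $\mathcal S_a$ the category defined below. The functor $\mathrm{Quo}:\mathcal S_a\to\mathcal G$ is left adjoint to the functor $S_a:\mathcal G\to\mathcal S_a$; that is, there are bijections $\operatorname{Hom}_{\mathcal G}(\mathrm{Quo}(T),G)\to\operatorname{Hom}_{\mathcal S_a}(T,S_a(G))$, natural in the finite association scheme $T$ and the finite group $G$.
   Context: An association scheme on a finite set $X$ is a partition $S$ of $X\times X$ into nonempty subsets such that $1_X=\{(x,x):x\in X\}\in S$; for each $s\in S$, $s^*=\{(x,y):(y,x)\in s\}\in S$; and for all $p,q,r\in S$ there is an integer $a_{pq}^r\ge0$ with $|\{y:(x,y)\in p,(y,z)\in q\}|=a_{pq}^r$ whenever $(x,z)\in r$. Complex product: $PQ=\{r:a_{pq}^r>0\text{ for some }p\in P,q\in Q\}$. A nonempty $T\subseteq S$ is closed if $TT=T$; it is strongly normal if $p^*Tp=T$ for all $p\in S$. For closed $T$, $xT=\{y:(x,y)\in t\text{ for some }t\in T\}$, $X/T$ is the set of these cosets, $s^T=\{(xT,yT):(x',y')\in s\text{ for some }x'\in xT,y'\in yT\}$, and $S/\!/T=\{s^T:s\in S\}$ is a scheme on $X/T$. The thin residue $O^\vartheta(S)$ is the intersection of all strongly normal closed subsets of $S$; $S/\!/O^\vartheta(S)$ is thin (all valencies $n_s=|\{y:(x,y)\in s\}|$ equal 1). $\mathrm{Quo}(S)$ is the group of singletons $\{s^{O^\vartheta(S)}\}$ under complex product in $S/\!/O^\vartheta(S)$. A morphism from a scheme $S$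 on $X$ to a scheme $T$ on $Y$ is a function $\phi:X\cup S\to Y\cup T$ with $\phi(X)\subseteq Y$, $\phi(S)\subseteq T$, and $(\phi(x_1),\phi(x_2))\in\phi(s)$ whenever $(x_1,x_2)\in s$; it is admissible if whenever $(\phi(x),y)\in\phi(s)$ there is $x'\in X$ with $\phi(x')=y$ and $(x,x')\in s$. Admissible $\phi,\phi'$ are algebraically equivalent if $\phi(s)=\phi'(s)$ for all $s$. $\mathcal S_a$ has finite association schemes as objects and algebraic equivalence classes of admissible morphisms as morphisms. For an admissible $\phi:S\to T$, $\mathrm{Quo}(\phi)(\{s^{O^\vartheta(S)}\})=\{\phi(s)^{O^\vartheta(T)}\}$, making $\mathrm{Quo}$ a functor. For a finite group $G$, $S(G)$ is the thin scheme on $G$ with elements $g\tilde{\ }=\{(g_1,g_2):g_2=g_1g\}$; for a homomorphism $f$, $S(f)$ sends $g\mapsto f(g)$, $g\tilde{\ }\mapsto f(g)\tilde{\ }$; $S_a(G)=S(G)$ and $S_a(f)$ is the class of $S(f)$. -}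

module Defs where

open import Data.Nat using (ℕ; _<_)
open import Data.Fin using (Fin; _≟_)
open import Data.Fin.Subset using (Subset; _∈_)
open import Data.List using (map; allFin)
open import Data.Nat.ListAction using (sum)
open import Data.Product using (Σ; ∃; ∃-syntax; _×_; _,_; proj₁; proj₂)
open import Function.Bundles using (_⇔_)
open import Relation.Nullary using (Dec; yes; no)
open import Relation.Nullary.Decidable using (_×-dec_)
open import Relation.Binary.PropositionalEquality using (_≡_; cong; trans)
open import Algebra.Structures using (IsGroup)

#_ : {n : ℕ} {P : Fin n → Set} → ((i : Fin n) → Dec (P i)) → ℕ
#_ {n} d = sum (map (λ i → ind (d i)) (allFin n))
  where
  ind : ∀ {A : Set} → Dec A → ℕ
  ind (yes _) = 1
  ind (no _)  = 0

-- The underlying set X is Fin n and the set of relations S is Fin m;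
-- rel x y is the unique s ∈ S with (x,y) ∈ s, i.e. S is a partition of
-- X × X; relation s is the set of pairs {(x,y) : rel x y ≡ s}.

pathCount : {n m : ℕ} → (Fin n → Fin n → Fin m) → Fin m → Fin m → Fin n → Fin n → ℕ
pathCount rel p q x z = # (λ y → (rel x y ≟ p) ×-dec (rel y z ≟ q))

record Scheme : Set where
  field
    n   : ℕ
    m   : ℕ
    rel : Fin n → Fin n → Fin m
    nonempty : (s : Fin m) → Σ (Fin n × Fin n) λ xy → rel (proj₁ xy) (proj₂ xy) ≡ s
    one      : Fin m
    one-diag : (x y : Fin n) → (rel x y ≡ one) ⇔ (x ≡ y)
    star     : Fin m → Fin m
    star-tr  : (s : Fin m) (x y : Fin n) → (rel x y ≡ s) ⇔ (rel y x ≡ star s)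
    regular  : (p q : Fin m) (x z x' z' : Fin n) → rel x z ≡ rel x' z' →
               pathCount rel p q x z ≡ pathCount rel p q x' z'

module SchemeNotions (S : Scheme) where
  open Scheme S

  a : Fin m → Fin m → Fin m → ℕ
  a p q r = pathCount rel p q (proj₁ (proj₁ (nonempty r))) (proj₂ (proj₁ (nonempty r)))

  _·_ : (Fin m → Set) → (Fin m → Set) → (Fin m → Set)
  (P · Q) r = ∃[ p ] ∃[ q ] (P p × Q q × 0 < a p q r)

  ⟦_⟧ : Subset m → Fin m → Set
  ⟦ T ⟧ s = s ∈ T

  ｛_｝ : Fin m → Fin m → Set
  ｛ p ｝ s = s ≡ p

  Closed : Subset m → Set
  Closed T = (∃[ t ] t ∈ T) × ((r : Fin m) → (⟦ T ⟧ · ⟦ T ⟧) r ⇔ r ∈ T)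

  StronglyNormal : Subset m → Set
  StronglyNormal T = (p r : Fin m) → ((｛ star p ｝ · ⟦ T ⟧) · ｛ p ｝) r ⇔ r ∈ T

  -- thin residue O^ϑ(S): intersection of all strongly normal closed subsets
  InO : Fin m → Set
  InO s = (T : Subset m) → Closed T → StronglyNormal T → s ∈ T

  _∈coset_ : Fin n → Fin n → Set
  y ∈coset x = InO (rel x y)

  -- (xO, yO) ∈ s^{O}
  QRel : Fin m → Fin n → Fin n → Set
  QRel s x y = ∃[ x' ] ∃[ y' ] (x' ∈coset x × y' ∈coset y × rel x' y' ≡ s)

  QEq : Fin m → Fin m → Set
  QEq s s' = (x y : Fin n) → QRel s x y ⇔ QRel s' x y

  -- r^{O} ∈ {s^{O}}{s'^{O}} in S//O^ϑ(S), i.e. a_{s^O s'^O}^{r^O} > 0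
  QProd : Fin m → Fin m → Fin m → Set
  QProd s s' r = ∃[ x ] ∃[ y ] ∃[ z ] (QRel r x z × QRel s x y × QRel s' y z)

record FinGroup : Set where
  field
    k       : ℕ
    _∙_     : Fin k → Fin k → Fin k
    ε       : Fin k
    _⁻¹     : Fin k → Fin k
    isGroup : IsGroup _≡_ _∙_ ε _⁻¹

record GroupHom (G H : FinGroup) : Set where
  private
    module G = FinGroup G
    module H = FinGroup H
  field
    fun  : Fin G.k → Fin H.k
    hom  : (x y : Fin G.k) → fun (x G.∙ y) ≡ fun x H.∙ fun y

-- An element {s^O} of Quo(T) is
-- represented by s ∈ T; a homomorphism is a map on representatives that
-- is well defined on s^O and multiplicative for the complex product.

record QuoHom (T : Scheme) (G : FinGroup) : Set where
  open Scheme T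
  open SchemeNotions T
  open FinGroup G
  field
    fun  : Fin m → Fin k
    wd   : (s s' : Fin m) → QEq s s' → fun s ≡ fun s'
    mult : (s s' r : Fin m) → QProd s s' r → fun r ≡ fun s ∙ fun s'

_≈Q_ : {T : Scheme} {G : FinGroup} → QuoHom T G → QuoHom T G → Set
_≈Q_ {T} f f' = (s : Fin (Scheme.m T)) → QuoHom.fun f s ≡ QuoHom.fun f' s

_∘Q_ : {T : Scheme} {G H : FinGroup} → GroupHom G H → QuoHom T G → QuoHom T H
_∘Q_ {T} {G} {H} h f = record
  { fun  = λ s → GroupHom.fun h (QuoHom.fun f s)
  ; wd   = λ s s' e → cong (GroupHom.fun h) (QuoHom.wd f s s' e)
  ; mult = λ s s' r p → trans (cong (GroupHom.fun h) (QuoHom.mult f s s' r p))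
                              (GroupHom.hom h _ _)
  }

record AdmMor (T' T : Scheme) : Set where
  private
    module T' = Scheme T'
    module T  = Scheme T
  field
    onPts : Fin T'.n → Fin T.n
    onRel : Fin T'.m → Fin T.m
    preserves  : (x₁ x₂ : Fin T'.n) → T.rel (onPts x₁) (onPts x₂) ≡ onRel (T'.rel x₁ x₂)
    admissible : (x : Fin T'.n) (s : Fin T'.m) (y : Fin T.n) →
                 T.rel (onPts x) y ≡ onRel s →
                 ∃[ x' ] (onPts x' ≡ y × T'.rel x x' ≡ s)

-- Admissible morphisms T → S(G), where S(G) is the thin scheme on G whose
-- relations are g~ = {(g₁,g₂) : g₂ = g₁ g}; the relation g~ is indexed by g.
record AdmMorG (T : Scheme) (G : FinGroup) : Set where
  open Scheme T
  open FinGroup G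
  field
    onPts : Fin n → Fin k
    onRel : Fin m → Fin k
    preserves  : (x₁ x₂ : Fin n) (s : Fin m) → rel x₁ x₂ ≡ s →
                 onPts x₂ ≡ onPts x₁ ∙ onRel s
    admissible : (x : Fin n) (s : Fin m) (g : Fin k) →
                 g ≡ onPts x ∙ onRel s →
                 ∃[ x' ] (onPts x' ≡ g × rel x x' ≡ s)

-- algebraic equivalence (equality of morphisms in 𝒮_a)
_≈A_ : {T : Scheme} {G : FinGroup} → AdmMorG T G → AdmMorG T G → Set
_≈A_ {T} φ φ' = (s : Fin (Scheme.m T)) → AdmMorG.onRel φ s ≡ AdmMorG.onRel φ' s

module Submission where

-- Elements of Quo(T) are represented by relations s of T, so a
-- homomorphism Quo(T) → G and an admissible morphism T → S(G) can both be
-- read as maps F from the relations of T to G; the bijection Φ keeps F and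
-- only has to supply (resp. forget) the map on points.
--
--  * counting: a path count is positive iff a path exists, hence
--    a_{pq}^r > 0 iff there is a triangle of type (p, q, r), and every point
--    has an s-neighbour for every relation s;
--  * every closed subset contains 1_X (pigeonhole on an iterated walk), so
--    each point lies in its own O^ϑ-coset and every s-edge is an s^O-edge;
--  * forward direction: a homomorphism f : Quo(T) → G is a cocycle on
--    edges, so x ↦ f(rel x₀ x) is an admissible morphism with relation map f;
--  * backward direction: the relation map F of an admissible φ : T → S(G)
--    is multiplicative on triangles, its kernel is closed and strongly
--    normal, hence contains O^ϑ(T), so F is constant on O^ϑ-cosets and
--    defines a homomorphism Quo(T) → G.
-- Since Φ does not change the relation map, bijectivity and both
-- naturality squares then hold on the nose.

open import Defs
open import Data.Fin using (Fin)
open import Data.Product using (Σ; ∃-syntax; _×_)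
open import Relation.Binary.PropositionalEquality using (_≡_)

open import Level using (0ℓ)
open import Algebra.Bundles using (Group)
open import Algebra.Structures using (IsGroup)
import Algebra.Properties.Group as GroupProperties
open import Data.Empty using (⊥; ⊥-elim)
open import Data.Fin using (toℕ; _≟_)
open import Data.Fin.Properties using (pigeonhole)
open import Data.Fin.Subset using (Subset; _∈_)
open import Data.List using (List; []; _∷_; map; allFin)
open import Data.List.Membership.Propositional using () renaming (_∈_ to _∈ᴸ_)
open import Data.List.Membership.Propositional.Properties using (∈-allFin)
open import Data.List.Relation.Unary.Any using (here; there)
open import Data.Nat using (ℕ; zero; suc; _<_; _<′_; z≤n; s≤s)
open import Data.Nat.Base using (<′-base; <′-step)
open import Data.Nat.ListAction using (sum)
open import Data.Nat.Properties
  using (m+n≡0⇒m≡0; m+n≡0⇒n≡0; n≢0⇒n>0; <-irrefl; n<1+n; <⇒<′)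
open import Data.Product using (∃; _,_; proj₁; proj₂)
open import Data.Vec using (tabulate)
open import Data.Vec.Properties using (lookup∘tabulate; []=⇒lookup; lookup⇒[]=)
open import Function.Bundles using (_⇔_; mk⇔; Equivalence)
open import Relation.Nullary using (Dec; yes; no; does; proof)
open import Relation.Nullary.Decidable using (dec-true)
open import Relation.Nullary.Reflects using (Reflects; invert)
open import Relation.Binary.PropositionalEquality
  using (refl; sym; trans; cong; cong₂; subst; module ≡-Reasoning)

sum-zero : ∀ {A : Set} (h : A → ℕ) (xs : List A) {a : A} →
           sum (map h xs) ≡ 0 → a ∈ᴸ xs → h a ≡ 0
sum-zero h (x ∷ xs) e (here refl)  = m+n≡0⇒m≡0 (h x) e
sum-zero h (x ∷ xs) e (there a∈xs) = sum-zero h xs (m+n≡0⇒n≡0 (h x) e) a∈xs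

sum-positive : ∀ {A : Set} (h : A → ℕ) (xs : List A) →
               0 < sum (map h xs) → ∃ λ a → 0 < h a
sum-positive h (x ∷ xs) pos with h x in hx≡
... | zero  = sum-positive h xs pos
... | suc _ = x , subst (0 <_) (sym hx≡) (s≤s z≤n)

count-witness : ∀ {n} {P : Fin n → Set} (d : ∀ i → Dec (P i)) (i : Fin n) →
                P i → 0 < # d
count-witness d i p = n≢0⇒n>0 count≢0
  where
  count≢0 : # d ≡ 0 → ⊥
  count≢0 e with d i | sum-zero _ (allFin _) e (∈-allFin i)
  ... | yes _ | ()
  ... | no ¬p | _ = ¬p p

count-positive : ∀ {n} {P : Fin n → Set} (d : ∀ i → Dec (P i)) →
                 0 < # d → ∃ P
count-positive d pos with sum-positive _ (allFin _) pos
... | i , pos-i with d i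
... | yes p = i , p
... | no _  = ⊥-elim (<-irrefl refl pos-i)

decSubset : ∀ {m} {P : Fin m → Set} → (∀ i → Dec (P i)) → Subset m
decSubset P? = tabulate (λ i → does (P? i))

∈-decSubset : ∀ {m} {P : Fin m → Set} (P? : ∀ i → Dec (P i)) {i : Fin m} →
              i ∈ decSubset P? ⇔ P i
∈-decSubset {P = P} P? {i} = mk⇔
  (λ i∈ → invert (subst (Reflects (P i))
     (trans (sym (lookup∘tabulate _ i)) ([]=⇒lookup i∈)) (proof (P? i))))
  (λ p → lookup⇒[]= i _ (trans (lookup∘tabulate _ i) (dec-true (P? i) p)))

module GroupFacts (G : FinGroup) where
  open FinGroup G

  asGroup : Group 0ℓ 0ℓ
  asGroup = record
    { Carrier = Fin k ; _≈_ = _≡_ ; _∙_ = _∙_ ; ε = ε ; _⁻¹ = _⁻¹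
    ; isGroup = isGroup }

  open IsGroup isGroup public using (assoc; identityʳ)
  open GroupProperties asGroup public using (∙-cancelˡ; identityʳ-unique)

module SchemeFacts (T : Scheme) where
  open Scheme T
  open SchemeNotions T

  basePoint : Fin n
  basePoint = proj₁ (proj₁ (nonempty one))

  rel-refl : ∀ x → rel x x ≡ one
  rel-refl x = Equivalence.from (one-diag x x) refl

  data Triangle (p q r : Fin m) : Set where
    triangle : ∀ {x y z} → rel x y ≡ p → rel y z ≡ q → rel x z ≡ r →
               Triangle p q r

  unit-triangle : ∀ r → Triangle r one r
  unit-triangle r with nonempty r
  ... | (_ , z) , x→z = triangle x→z (rel-refl z) x→z

  star-triangle : ∀ p → Triangle (star p) p one
  star-triangle p with nonempty p
  ... | (x , y) , x→y = triangle (Equivalence.to (star-tr p x y) x→y) x→y (rel-refl y)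

  path-positive : ∀ {p q x y z} → rel x y ≡ p → rel y z ≡ q →
                  0 < pathCount rel p q x z
  path-positive {y = y} e₁ e₂ = count-witness _ y (e₁ , e₂)

  path-witness : ∀ {p q x z} → 0 < pathCount rel p q x z →
                 ∃ λ y → rel x y ≡ p × rel y z ≡ q
  path-witness = count-positive _

  -- a_{pq}^r > 0 iff a triangle of type (p, q, r) exists; by regularity the
  -- count may be taken at any r-edge.
  a-positive : ∀ {p q r} → Triangle p q r → 0 < a p q r
  a-positive {p} {q} {r} (triangle {x} {_} {z} e₁ e₂ e₃) =
    subst (0 <_) (regular p q x z _ _ (trans e₃ (sym (proj₂ (nonempty r)))))
      (path-positive e₁ e₂)

  positive-triangle : ∀ {p q r} → 0 < a p q r → Triangle p q r
  positive-triangle {r = r} pos with path-witness pos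
  ... | _ , e₁ , e₂ = triangle e₁ e₂ (proj₂ (nonempty r))

  -- Round trips x —s→ y —s*→ x exist at every x: by regularity their count
  -- at (x, x) equals the count at (x₀, x₀) for a recorded s-edge x₀ —s→ y₀.
  round-trip : ∀ x s → 0 < pathCount rel s (star s) x x
  round-trip x s with nonempty s
  ... | (x₀ , y₀) , e =
    subst (0 <_) (regular s (star s) x₀ x₀ x x (trans (rel-refl x₀) (sym (rel-refl x))))
      (path-positive e (Equivalence.to (star-tr s x₀ y₀) e))

  neighbour : ∀ x s → ∃ λ y → rel x y ≡ s
  neighbour x s with path-witness (round-trip x s)
  ... | y , x→y , _ = y , x→y

  -- A closed subset C contains 1_X: walking along a fixed t ∈ C, every
  -- later point is reached from an earlier one by a relation of C, and by
  -- pigeonhole the walk revisits a point.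
  module ClosedSubset {C : Subset m} (closed : Closed C) where
    compose∈ : ∀ {x y z} → rel x y ∈ C → rel y z ∈ C → rel x z ∈ C
    compose∈ xy∈ yz∈ = Equivalence.to (proj₂ closed _)
      (_ , _ , xy∈ , yz∈ , a-positive (triangle refl refl refl))

    t : Fin m
    t = proj₁ (proj₁ closed)

    walk : ℕ → Fin n
    walk zero    = basePoint
    walk (suc i) = proj₁ (neighbour (walk i) t)

    step∈ : ∀ i → rel (walk i) (walk (suc i)) ∈ C
    step∈ i = subst (_∈ C) (sym (proj₂ (neighbour (walk i) t))) (proj₂ (proj₁ closed))

    walk∈ : ∀ {i j} → i <′ j → rel (walk i) (walk j) ∈ C
    walk∈ {i} <′-base           = step∈ i
    walk∈ (<′-step {j} i<j) = compose∈ (walk∈ i<j) (step∈ j)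

    one∈ : one ∈ C
    one∈ with pigeonhole (n<1+n n) (λ i → walk (toℕ i))
    ... | i , j , i<j , same =
      subst (_∈ C) (rel-refl _)
        (subst (λ w → rel w (walk (toℕ j)) ∈ C) same (walk∈ (<⇒<′ i<j)))

  one∈residue : InO one
  one∈residue C closed _ = ClosedSubset.one∈ closed

  coset-refl : ∀ x → x ∈coset x
  coset-refl x = subst InO (sym (rel-refl x)) one∈residue

  rel⇒QRel : ∀ {s x y} → rel x y ≡ s → QRel s x y
  rel⇒QRel e = _ , _ , coset-refl _ , coset-refl _ , e

module Transpose (T : Scheme) (G : FinGroup) (f : QuoHom T G) where
  open Scheme T
  open SchemeFacts T
  open FinGroup G
  open QuoHom f

  cocycle : ∀ x y z → fun (rel x z) ≡ fun (rel x y) ∙ fun (rel y z)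
  cocycle x y z = mult (rel x y) (rel y z) (rel x z)
    (x , y , z , rel⇒QRel refl , rel⇒QRel refl , rel⇒QRel refl)

  points : Fin n → Fin k
  points y = fun (rel basePoint y)

  edge : ∀ {x y s} → rel x y ≡ s → points y ≡ points x ∙ fun s
  edge {x} {y} refl = cocycle basePoint x y

  transpose : AdmMorG T G
  transpose = record
    { onPts      = points
    ; onRel      = fun
    ; preserves  = λ _ _ _ → edge
    ; admissible = λ x s g g≡ →
        let (y , x→y) = neighbour x s in y , trans (edge x→y) (sym g≡) , x→y
    }

Φ : (T : Scheme) (G : FinGroup) → QuoHom T G → AdmMorG T G
Φ = Transpose.transpose

module AdmissibleKernel (T : Scheme) (G : FinGroup) (φ : AdmMorG T G) where
  open Scheme T
  open SchemeNotions T
  open SchemeFacts T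
  open FinGroup G
  open GroupFacts G
  open AdmMorG φ renaming (onPts to P; onRel to F)
  open ≡-Reasoning

  edge : ∀ x y → P y ≡ P x ∙ F (rel x y)
  edge x y = preserves x y _ refl

  F-triangle : ∀ {p q r} → Triangle p q r → F r ≡ F p ∙ F q
  F-triangle (triangle {x} {y} {z} refl refl refl) = ∙-cancelˡ (P x) _ _ (begin
    P x ∙ F (rel x z)                  ≡⟨ sym (edge x z) ⟩
    P z                                ≡⟨ edge y z ⟩
    P y ∙ F (rel y z)                  ≡⟨ cong (_∙ F (rel y z)) (edge x y) ⟩
    (P x ∙ F (rel x y)) ∙ F (rel y z)  ≡⟨ assoc _ _ _ ⟩
    P x ∙ (F (rel x y) ∙ F (rel y z))  ∎)

  F-mult : ∀ {p q r} → 0 < a p q r → F r ≡ F p ∙ F q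
  F-mult pos = F-triangle (positive-triangle pos)

  F-one : F one ≡ ε
  F-one = identityʳ-unique (F one) (F one) (sym (F-triangle (unit-triangle one)))

  F-star : ∀ p → F (star p) ∙ F p ≡ ε
  F-star p = trans (sym (F-triangle (star-triangle p))) F-one

  kernel : Subset m
  kernel = decSubset (λ s → F s ≟ ε)

  ∈kernel : ∀ {s} → s ∈ kernel ⇔ F s ≡ ε
  ∈kernel = ∈-decSubset (λ s → F s ≟ ε)

  kernel-edge : ∀ {x y} → rel x y ∈ kernel → P y ≡ P x
  kernel-edge {x} {y} x→y∈ =
    trans (edge x y) (trans (cong (P x ∙_) (Equivalence.to ∈kernel x→y∈)) (identityʳ (P x)))

  edge-kernel : ∀ {x y} → P y ≡ P x → rel x y ∈ kernel
  edge-kernel {x} {y} same =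
    Equivalence.from ∈kernel (identityʳ-unique (P x) _ (trans (sym (edge x y)) same))

  kernel-closed : Closed kernel
  kernel-closed = (one , Equivalence.from ∈kernel F-one) , λ r → mk⇔ product⊆ (⊆product r)
    where
    product⊆ : ∀ {r} → (⟦ kernel ⟧ · ⟦ kernel ⟧) r → r ∈ kernel
    product⊆ {r} (p , q , p∈ , q∈ , pos) = Equivalence.from ∈kernel (begin
      F r        ≡⟨ F-mult pos ⟩
      F p ∙ F q  ≡⟨ cong₂ _∙_ (Equivalence.to ∈kernel p∈) (Equivalence.to ∈kernel q∈) ⟩
      ε ∙ ε      ≡⟨ identityʳ ε ⟩
      ε          ∎)

    ⊆product : ∀ r → r ∈ kernel → (⟦ kernel ⟧ · ⟦ kernel ⟧) r
    ⊆product r r∈ =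
      r , one , r∈ , Equivalence.from ∈kernel F-one , a-positive (unit-triangle r)

  kernel-normal : StronglyNormal kernel
  kernel-normal p r = mk⇔ conjugate⊆ ⊆conjugate
    where
    conjugate⊆ : ((｛ star p ｝ · ⟦ kernel ⟧) · ｛ p ｝) r → r ∈ kernel
    conjugate⊆ (u , _ , (_ , v , refl , v∈ , pos-u) , refl , pos-r) =
      Equivalence.from ∈kernel (begin
        F r                      ≡⟨ F-mult pos-r ⟩
        F u ∙ F p                ≡⟨ cong (_∙ F p) (F-mult pos-u) ⟩
        (F (star p) ∙ F v) ∙ F p ≡⟨ cong (λ g → (F (star p) ∙ g) ∙ F p) (Equivalence.to ∈kernel v∈) ⟩
        (F (star p) ∙ ε) ∙ F p   ≡⟨ cong (_∙ F p) (identityʳ _) ⟩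
        F (star p) ∙ F p         ≡⟨ F-star p ⟩
        ε                        ∎)

    -- Given an r-edge x —→ z in the kernel, admissibility lifts the p*-steps
    -- z —p*→ w and x —p*→ v with P v = P w, giving x —p*→ v —→ w —p→ z.
    ⊆conjugate : r ∈ kernel → ((｛ star p ｝ · ⟦ kernel ⟧) · ｛ p ｝) r
    ⊆conjugate r∈ = through (proj₂ (nonempty r))
      where
      through : ∀ {x z} → rel x z ≡ r → ((｛ star p ｝ · ⟦ kernel ⟧) · ｛ p ｝) r
      through {x} {z} x→z with admissible z (star p) _ refl
      ... | w , Pw , z→w with admissible x (star p) (P w)
            (trans Pw (cong (_∙ F (star p)) (kernel-edge (subst (_∈ kernel) (sym x→z) r∈))))
      ... | v , Pv , x→v =
        rel x w , p ,
        (star p , rel v w , refl , edge-kernel (sym Pv) , a-positive (triangle x→v refl refl)) ,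
        refl , a-positive (triangle refl (Equivalence.from (star-tr p w z) z→w) x→z)

  residue⊆kernel : ∀ {s} → InO s → F s ≡ ε
  residue⊆kernel s∈O = Equivalence.to ∈kernel (s∈O kernel kernel-closed kernel-normal)

  coset-point : ∀ {x y} → y ∈coset x → P y ≡ P x
  coset-point y∈xO = kernel-edge (Equivalence.from ∈kernel (residue⊆kernel y∈xO))

  QRel-edge : ∀ {s x y} → QRel s x y → P y ≡ P x ∙ F s
  QRel-edge {s} {x} {y} (x′ , y′ , x′∈xO , y′∈yO , x′→y′) = begin
    P y        ≡⟨ sym (coset-point y′∈yO) ⟩
    P y′       ≡⟨ preserves x′ y′ s x′→y′ ⟩
    P x′ ∙ F s ≡⟨ cong (_∙ F s) (coset-point x′∈xO) ⟩
    P x ∙ F s  ∎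

  common-edge : ∀ {s s′ x y} → QRel s x y → QRel s′ x y → F s ≡ F s′
  common-edge {x = x} q q′ = ∙-cancelˡ (P x) _ _ (trans (sym (QRel-edge q)) (QRel-edge q′))

  quoHom : QuoHom T G
  quoHom = record
    { fun  = F
    ; wd   = λ s s′ same →
        let q = rel⇒QRel (proj₂ (nonempty s)) in common-edge q (Equivalence.to (same _ _) q)
    ; mult = λ { s s′ r (x , y , z , x→z , x→y , y→z) → ∙-cancelˡ (P x) _ _ (begin
        P x ∙ F r          ≡⟨ sym (QRel-edge x→z) ⟩
        P z                ≡⟨ QRel-edge y→z ⟩
        P y ∙ F s′         ≡⟨ cong (_∙ F s′) (QRel-edge x→y) ⟩
        (P x ∙ F s) ∙ F s′ ≡⟨ assoc _ _ _ ⟩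
        P x ∙ (F s ∙ F s′) ∎) }
    }

proposition5p5 :
    Σ ((T : Scheme) (G : FinGroup) → QuoHom T G → AdmMorG T G) λ Φ →
      ( (T : Scheme) (G : FinGroup) →
          ((f f' : QuoHom T G) → f ≈Q f' → Φ T G f ≈A Φ T G f')
        × ((f f' : QuoHom T G) → Φ T G f ≈A Φ T G f' → f ≈Q f')
        × ((φ : AdmMorG T G) → ∃[ f ] (Φ T G f ≈A φ)) )
      × ( (T' T : Scheme) (G : FinGroup) (ψ : AdmMor T' T) (f : QuoHom T G)
          (fψ : QuoHom T' G) →
          ((s : Fin (Scheme.m T')) →
             QuoHom.fun fψ s ≡ QuoHom.fun f (AdmMor.onRel ψ s)) →
          (s : Fin (Scheme.m T')) →
            AdmMorG.onRel (Φ T' G fψ) s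
              ≡ AdmMorG.onRel (Φ T G f) (AdmMor.onRel ψ s) )
      × ( (T : Scheme) (G H : FinGroup) (h : GroupHom G H) (f : QuoHom T G) →
          (s : Fin (Scheme.m T)) →
            AdmMorG.onRel (Φ T H (h ∘Q f)) s
              ≡ GroupHom.fun h (AdmMorG.onRel (Φ T G f) s) )
proposition5p5 =
  Φ ,
  -- Φ keeps the relation map, so it is injective and well defined on ≈;
  -- surjectivity is the factorisation of the relation map through Quo(T).
  (λ T G → (λ _ _ f≈f′ → f≈f′) , (λ _ _ Φf≈Φf′ → Φf≈Φf′) ,
           (λ φ → AdmissibleKernel.quoHom T G φ , λ _ → refl)) ,
  -- naturality in T and in G: both sides are the same relation map
  (λ _ _ _ _ _ _ fψ≡f∘ψ → fψ≡f∘ψ) ,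
  (λ _ _ _ _ _ _ → refl)
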